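{- Let $\mathbf{s}$ be an automatic sequence and let $k\ge1$ be an integer such that $\mathbf{s}$ is not $k$-pseudoperiodic. Then there exists a constant $C$ (depending only on $\mathbf{s}$ and $k$) such that for all integers $0<p_1<p_2<\cdots<p_k$, the smallest $n\ge0$ for which $\mathbf{s}[n]\notin\{\mathbf{s}[n+p_1],\mathbf{s}[n+p_2],\ldots,\mathbf{s}[n+p_k]\}$ satisfies $n\le Cp_k$.
   Context: Sequences are indexed starting at $0$. A sequence $\mathbf{s}$ over a finite alphabet is automatic if for some integer base $b\ge2$ there is a deterministic finite automaton with output which, given the base-$b$ representation of $n$ as input, outputs $\mathbf{s}[n]$. For integers $k\ge1$ and $0<p_1<\cdots<p_k$, $\mathbf{s}$ has pseudoperiod $(p_1,\ldots,p_k)$ if $\mathbf{s}[i]\in\{\mathbf{s}[i+p_1],\ldots,\mathbf{s}[i+p_k]\}$ for all $i\ge0$; it is $k$-pseudoperiodic if it has some pseudoperiod with exactly $k$ entries. -}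

module Defs where

open import Data.Nat using (ℕ; zero; suc; _+_; _*_; _≤_; _<_; NonZero)
open import Data.Nat.DivMod using (_/_; _%_)
open import Data.Nat.Properties using (_≟_)
open import Data.Fin using (Fin; fromℕ<)
open import Data.Fin.Base using (fromℕ)
import Data.Fin as F
open import Data.List using (List; []; _∷_; reverse; foldl)
open import Data.Nat.DivMod using (m%n<n)
open import Data.Product using (Σ; ∃; _×_; _,_)
open import Relation.Binary.PropositionalEquality using (_≡_)
open import Relation.Nullary using (¬_; yes; no)

-- Least-significant-digit-first base-b digits of n (no leading zeros;
-- 0 is represented by the empty word).  The first argument is fuel (n suffices).
lsdDigits : (b : ℕ) → .{{NonZero b}} → ℕ → ℕ → List (Fin b)
lsdDigits b zero    n = []
lsdDigits b (suc f) n with n ≟ 0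
... | yes _ = []
... | no  _ = fromℕ< (m%n<n n b) ∷ lsdDigits b f (n / b)

baseRep : (b : ℕ) → .{{NonZero b}} → ℕ → List (Fin b)
baseRep b n = reverse (lsdDigits b n n)

record DFAO (b m : ℕ) : Set where
  field
    q      : ℕ
    init   : Fin q
    δ      : Fin q → Fin b → Fin q
    output : Fin q → Fin m

runDFAO : ∀ {b m} → .{{NonZero b}} → DFAO b m → ℕ → Fin m
runDFAO {b} M n = DFAO.output M (foldl (DFAO.δ M) (DFAO.init M) (baseRep b n))

Automatic : ∀ {m} → (ℕ → Fin m) → Set
Automatic {m} s =
  Σ ℕ λ b → Σ (2 ≤ b) λ _ → Σ (NonZero b) λ nz →
    Σ (DFAO b m) λ M → ∀ n → s n ≡ runDFAO {{nz}} M n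

ValidPeriods : ∀ {k} → (Fin k → ℕ) → Set
ValidPeriods {k} p = (∀ i → 0 < p i) × (∀ i j → i F.< j → p i < p j)

Covered : ∀ {m k} → (ℕ → Fin m) → (Fin k → ℕ) → ℕ → Set
Covered s p i = ∃ λ j → s i ≡ s (i + p j)

HasPseudoperiod : ∀ {m k} → (ℕ → Fin m) → (Fin k → ℕ) → Set
HasPseudoperiod s p = ∀ i → Covered s p i

Pseudoperiodic : ∀ {m} → ℕ → (ℕ → Fin m) → Set
Pseudoperiodic k s = Σ (Fin k → ℕ) λ p → ValidPeriods p × HasPseudoperiod s p

IsLeastFailure : ∀ {m k} → (ℕ → Fin m) → (Fin k → ℕ) → ℕ → Set
IsLeastFailure s p n = ¬ Covered s p n × (∀ i → i < n → Covered s p i)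

{-# OPTIONS --safe #-}
module Submission where

-- Let σ n be the state reached on the base-b digits of n, and call prefixes a, a′ ≥ 1
-- equivalent when σ a = σ a′ and σ (a + 1) = σ (a′ + 1).  Equivalent prefixes can be
-- swapped in front of any suffix x < 2·b^L without changing σ, because such a suffix
-- carries at most 1 into the prefix.  Pigeonholing the q² state pairs of the prefixes
-- of a shows that every prefix is equivalent to one below B = b^(q²).  Now choose
-- p_k < b^L ≤ b·p_k.  If every i < B·b^L were covered, then so would be every larger
-- i = a·b^L + r with r < b^L: swap a for a small equivalent prefix, take the covering
-- period p_j there, and swap back, which is allowed as r + p_j < 2·b^L.  So s would have
-- pseudoperiod p; hence the least failure lies below B·b^L ≤ B·b·p_k.

open import Defs
open import Data.Nat using (ℕ; zero; suc; _+_; _*_; _^_; _∸_; _≤_; _<_; z≤n; s≤s; NonZero; >-nonZero; _<?_)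
open import Data.Nat.Properties
open import Data.Nat.DivMod
open import Data.Nat.Divisibility using (n∣m*n)
open import Data.Nat.Induction using (<-wellFounded)
open import Data.Nat.Tactic.RingSolver using (solve-∀)
open import Data.Fin using (Fin; fromℕ; fromℕ<; toℕ; combine)
import Data.Fin.Properties as Fin
open import Data.List using (_∷_; reverse; foldl; _∷ʳ_)
open import Data.List.Properties using (foldl-∷ʳ; unfold-reverse)
open import Data.Product using (Σ; ∃; _×_; _,_; proj₁; proj₂)
open import Data.Sum using (_⊎_; inj₁; inj₂)
open import Data.Empty using (⊥-elim)
open import Function using (_∘_)
open import Induction.WellFounded using (Acc; acc)
open import Relation.Nullary using (¬_; yes; no)
open import Relation.Unary using (Decidable)
open import Relation.Binary.PropositionalEquality

m<n∧o<p⇒m*p+o<n*p : ∀ {m n o p} → m < n → o < p → m * p + o < n * p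
m<n∧o<p⇒m*p+o<n*p {m} {n} {o} {p} m<n o<p = begin-strict
  m * p + o    <⟨ +-monoʳ-< (m * p) o<p ⟩
  m * p + p    ≡⟨ +-comm (m * p) p ⟩
  suc m * p    ≤⟨ *-monoˡ-≤ p m<n ⟩
  n * p        ∎
  where open ≤-Reasoning

allBelow⊎leastCounterexample : ∀ {P : ℕ → Set} → Decidable P → ∀ T →
  (∀ i → i < T → P i) ⊎ ∃ λ n → n < T × ¬ P n × (∀ i → i < n → P i)
allBelow⊎leastCounterexample P? zero = inj₁ λ _ ()
allBelow⊎leastCounterexample {P} P? (suc T) with allBelow⊎leastCounterexample P? T
... | inj₂ (n , n<T , least) = inj₂ (n , m<n⇒m<1+n n<T , least)
... | inj₁ allBelowT with P? T
...   | no  ¬PT = inj₂ (T , ≤-refl , ¬PT , allBelowT)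
...   | yes PT  = inj₁ allBelow1+T
  where
  allBelow1+T : ∀ i → i < suc T → P i
  allBelow1+T i i<1+T with m≤n⇒m<n∨m≡n (≤-pred i<1+T)
  ... | inj₁ i<T  = allBelowT i i<T
  ... | inj₂ refl = PT

covered? : ∀ {m k} (s : ℕ → Fin m) (p : Fin k → ℕ) → Decidable (Covered s p)
covered? s p i = Fin.any? (λ j → s i Fin.≟ s (i + p j))

ValidPeriods⇒≤last : ∀ {k} {p : Fin (suc k) → ℕ} → ValidPeriods p → ∀ j → p j ≤ p (fromℕ k)
ValidPeriods⇒≤last {k} (_ , increasing) j with j Fin.≟ fromℕ k
... | yes refl = ≤-refl
... | no  j≢k  = <⇒≤ (increasing j (fromℕ k) (Fin.≤∧≢⇒< (Fin.≤fromℕ j) j≢k))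

module Digits {b : ℕ} {{_ : NonZero b}} (1<b : 1 < b) where

  [d+ab]/b≡a : ∀ {d} a → d < b → (d + a * b) / b ≡ a
  [d+ab]/b≡a {d} a d<b = begin
    (d + a * b) / b     ≡⟨ +-distrib-/-∣ʳ d (n∣m*n a) ⟩
    d / b + a * b / b   ≡⟨ cong₂ _+_ (m<n⇒m/n≡0 d<b) (m*n/n≡m a b) ⟩
    a                   ∎
    where open ≡-Reasoning

  [d+ab]%b≡d : ∀ {d} a → d < b → (d + a * b) % b ≡ d
  [d+ab]%b≡d {d} a d<b = trans ([m+kn]%n≡m%n d a b) (m<n⇒m%n≡m d<b)

  lsdDigits-fuel : ∀ {f f′ n} → n ≤ f → n ≤ f′ → lsdDigits b f n ≡ lsdDigits b f′ n
  lsdDigits-fuel {zero}  {zero}   {zero} _ _ = refl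
  lsdDigits-fuel {zero}  {suc _}  {zero} _ _ = refl
  lsdDigits-fuel {suc _} {zero}   {zero} _ _ = refl
  lsdDigits-fuel {suc _} {suc _}  {zero} _ _ = refl
  lsdDigits-fuel {suc f} {suc f′} {n@(suc _)} n≤1+f n≤1+f′ =
    cong (_ ∷_) (lsdDigits-fuel (n/b<n≤1+g n≤1+f) (n/b<n≤1+g n≤1+f′))
    where
    n/b<n≤1+g : ∀ {g} → n ≤ suc g → n / b ≤ g
    n/b<n≤1+g n≤1+g = ≤-pred (≤-trans (m/n<m n b 1<b) n≤1+g)

  a≤d+a*b : ∀ d a → a ≤ d + a * b
  a≤d+a*b d a = ≤-trans (m≤m*n a b) (m≤n+m (a * b) d)

  lsdDigits-cons : ∀ {f d} a (d<b : d < b) → 1 ≤ a →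
                   lsdDigits b (suc f) (d + a * b) ≡ fromℕ< d<b ∷ lsdDigits b f a
  lsdDigits-cons {f} {d} a d<b 1≤a with d + a * b ≟ 0
  ... | yes d+ab≡0 = ⊥-elim (m<n⇒n≢0 {0} (≤-trans 1≤a (a≤d+a*b d a)) d+ab≡0)
  ... | no  _      = cong₂ _∷_ (Fin.fromℕ<-cong _ _ ([d+ab]%b≡d a d<b) _ _)
                               (cong (lsdDigits b f) ([d+ab]/b≡a a d<b))

  baseRep-snoc : ∀ {d} a (d<b : d < b) → 1 ≤ a → baseRep b (d + a * b) ≡ baseRep b a ∷ʳ fromℕ< d<b
  baseRep-snoc {d} a d<b 1≤a = begin
    reverse (lsdDigits b n n)                 ≡⟨ cong reverse (lsdDigits-fuel ≤-refl (n≤1+n n)) ⟩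
    reverse (lsdDigits b (suc n) n)           ≡⟨ cong reverse (lsdDigits-cons a d<b 1≤a) ⟩
    reverse (fromℕ< d<b ∷ lsdDigits b n a)    ≡⟨ cong (reverse ∘ (_ ∷_)) (lsdDigits-fuel (a≤d+a*b d a) ≤-refl) ⟩
    reverse (fromℕ< d<b ∷ lsdDigits b a a)    ≡⟨ unfold-reverse _ (lsdDigits b a a) ⟩
    baseRep b a ∷ʳ fromℕ< d<b                 ∎
    where
    open ≡-Reasoning
    n : ℕ
    n = d + a * b

  dropDigits : ℕ → ℕ → ℕ
  dropDigits k a = (a / b ^ k) {{m^n≢0 b k}}

  takeDigits : ℕ → ℕ → ℕ
  takeDigits k a = (a % b ^ k) {{m^n≢0 b k}}

  takeDigits< : ∀ k a → takeDigits k a < b ^ k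
  takeDigits< k a = m%n<n a (b ^ k) {{m^n≢0 b k}}

  dropDigits*b^+takeDigits : ∀ k a → dropDigits k a * b ^ k + takeDigits k a ≡ a
  dropDigits*b^+takeDigits k a =
    trans (+-comm (dropDigits k a * b ^ k) _) (sym (m≡m%n+[m/n]*n a (b ^ k) {{m^n≢0 b k}}))

  dropDigits>0 : ∀ {k a} → b ^ k ≤ a → 1 ≤ dropDigits k a
  dropDigits>0 {k} b^k≤a = m≥n⇒m/n>0 {{m^n≢0 b k}} b^k≤a

  dropDigits-decreasing : ∀ a {i j} → i < j → 1 ≤ dropDigits j a → dropDigits j a < dropDigits i a
  dropDigits-decreasing a {i} {j} i<j 1≤a/b^j = begin-strict
    a / b ^ j           ≤⟨ /-monoʳ-≤ a (^-monoʳ-≤ b i<j) ⟩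
    a / b ^ suc i       ≡⟨ /-congʳ (*-comm b (b ^ i)) ⟩
    a / (b ^ i * b)     ≡⟨ m/n/o≡m/[n*o] a (b ^ i) b ⟨
    a / b ^ i / b       <⟨ m/n<m (a / b ^ i) b 1<b ⟩
    a / b ^ i           ∎
    where
    open ≤-Reasoning
    instance
      b^i≢0 : NonZero (b ^ i)
      b^i≢0 = m^n≢0 b i
      b^j≢0 : NonZero (b ^ j)
      b^j≢0 = m^n≢0 b j
      b^1+i≢0 : NonZero (b ^ suc i)
      b^1+i≢0 = m^n≢0 b (suc i)
      b^i*b≢0 : NonZero (b ^ i * b)
      b^i*b≢0 = m*n≢0 (b ^ i) b
      a/b^i≢0 : NonZero (a / b ^ i)
      a/b^i≢0 = >-nonZero (≤-trans 1≤a/b^j (/-monoʳ-≤ a (^-monoʳ-≤ b (<⇒≤ i<j))))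

  ∃P<b^L≤b*P : ∀ {P} → 1 ≤ P → ∃ λ L → P < b ^ L × b ^ L ≤ b * P
  ∃P<b^L≤b*P {P} 1≤P = go P (<-wellFounded P) 1≤P
    where
    go : ∀ P → Acc _<_ P → 1 ≤ P → ∃ λ L → P < b ^ L × b ^ L ≤ b * P
    go P (acc rec) 1≤P with P <? b
    ... | yes P<b = 1 , subst (P <_) (sym (*-identityʳ b)) P<b , *-monoʳ-≤ b 1≤P
    ... | no  P≮b with go (P / b) (rec (m/n<m P b {{>-nonZero 1≤P}} 1<b)) (m≥n⇒m/n>0 (≮⇒≥ P≮b))
    ...   | L , P/b<b^L , b^L≤b[P/b] = suc L , P<b^1+L , b^1+L≤bP
      where
      open ≤-Reasoning
      P<b^1+L : P < b ^ suc L
      P<b^1+L = begin-strict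
        P                    ≡⟨ m≡m%n+[m/n]*n P b ⟩
        P % b + P / b * b    <⟨ +-monoˡ-< (P / b * b) (m%n<n P b) ⟩
        suc (P / b) * b      ≤⟨ *-monoˡ-≤ b P/b<b^L ⟩
        b ^ L * b            ≡⟨ *-comm (b ^ L) b ⟩
        b ^ suc L            ∎
      b^1+L≤bP : b ^ suc L ≤ b * P
      b^1+L≤bP = *-monoʳ-≤ b (≤-trans b^L≤b[P/b] (subst (_≤ P) (*-comm (P / b) b) (m/n*n≤m P b)))

module Automaton {b m : ℕ} {{_ : NonZero b}} (1<b : 1 < b) (M : DFAO b m) where
  open DFAO M
  open Digits 1<b

  state : ℕ → Fin q
  state n = foldl δ init (baseRep b n)

  state-snoc : ∀ {d} a (d<b : d < b) → 1 ≤ a → state (d + a * b) ≡ δ (state a) (fromℕ< d<b)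
  state-snoc a d<b 1≤a =
    trans (cong (foldl δ init) (baseRep-snoc a d<b 1≤a)) (foldl-∷ʳ δ init _ (baseRep b a))

  state-replacePrefix : ∀ L {a a′ y} → 1 ≤ a → 1 ≤ a′ → state a ≡ state a′ → y < b ^ L →
                        state (a * b ^ L + y) ≡ state (a′ * b ^ L + y)
  state-replacePrefix zero {a} {a′} {zero} _ _ eq _ = begin
    state (a * 1 + 0)     ≡⟨ cong state (trans (+-identityʳ _) (*-identityʳ a)) ⟩
    state a               ≡⟨ eq ⟩
    state a′              ≡⟨ cong state (trans (+-identityʳ _) (*-identityʳ a′)) ⟨
    state (a′ * 1 + 0)    ∎
    where open ≡-Reasoning
  state-replacePrefix zero {y = suc _} _ _ _ (s≤s ())
  state-replacePrefix (suc L) {a} {a′} {y} 1≤a 1≤a′ eq y<b^1+L = begin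
    state (a * b ^ suc L + y)                 ≡⟨ cong state (lastDigit-split a) ⟩
    state (y % b + (a * b ^ L + y / b) * b)   ≡⟨ state-snoc _ (m%n<n y b) (prefix>0 1≤a) ⟩
    δ (state (a * b ^ L + y / b)) d           ≡⟨ cong (λ σ → δ σ d)
                                                   (state-replacePrefix L 1≤a 1≤a′ eq y/b<b^L) ⟩
    δ (state (a′ * b ^ L + y / b)) d          ≡⟨ state-snoc _ (m%n<n y b) (prefix>0 1≤a′) ⟨
    state (y % b + (a′ * b ^ L + y / b) * b)  ≡⟨ cong state (lastDigit-split a′) ⟨
    state (a′ * b ^ suc L + y)                ∎
    where
    open ≡-Reasoning
    d : Fin b
    d = fromℕ< (m%n<n y b)
    y/b<b^L : y / b < b ^ L
    y/b<b^L = m<n*o⇒m/o<n (subst (y <_) (*-comm b (b ^ L)) y<b^1+L)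
    prefix>0 : ∀ {c} → 1 ≤ c → 1 ≤ c * b ^ L + y / b
    prefix>0 {c} 1≤c = ≤-trans 1≤c (≤-trans (m≤m*n c (b ^ L) {{m^n≢0 b L}}) (m≤m+n _ _))
    reassociate : ∀ c b X r t → c * (b * X) + (r + t * b) ≡ r + (c * X + t) * b
    reassociate = solve-∀
    lastDigit-split : ∀ c → c * b ^ suc L + y ≡ y % b + (c * b ^ L + y / b) * b
    lastDigit-split c =
      trans (cong (c * b ^ suc L +_) (m≡m%n+[m/n]*n y b)) (reassociate c b (b ^ L) (y % b) (y / b))

  statePair : ℕ → Fin (q * q)
  statePair a = combine (state a) (state (suc a))

  statePair-injective : ∀ {a a′} → statePair a ≡ statePair a′ →
                        state a ≡ state a′ × state (suc a) ≡ state (suc a′)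
  statePair-injective {a} {a′} = Fin.combine-injective (state a) _ (state a′) _

  state-replacePrefix₂ : ∀ L {a a′ x} → 1 ≤ a → 1 ≤ a′ → statePair a ≡ statePair a′ →
                         x < b ^ L + b ^ L → state (a * b ^ L + x) ≡ state (a′ * b ^ L + x)
  state-replacePrefix₂ L {a} {a′} {x} 1≤a 1≤a′ eq x<X+X with x <? b ^ L
  ... | yes x<X = state-replacePrefix L 1≤a 1≤a′ (proj₁ (statePair-injective {a} {a′} eq)) x<X
  ... | no  x≮X = begin
    state (a * X + x)               ≡⟨ cong state (carry a) ⟩
    state (suc a * X + (x ∸ X))     ≡⟨ state-replacePrefix L {suc a} {suc a′} (s≤s z≤n) (s≤s z≤n)
                                         (proj₂ (statePair-injective {a} {a′} eq)) x∸X<X ⟩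
    state (suc a′ * X + (x ∸ X))    ≡⟨ cong state (carry a′) ⟨
    state (a′ * X + x)              ∎
    where
    open ≡-Reasoning
    X : ℕ
    X = b ^ L
    X≤x : X ≤ x
    X≤x = ≮⇒≥ x≮X
    x∸X<X : x ∸ X < X
    x∸X<X = +-cancelʳ-< _ _ X (subst (_< X + X) (sym (m∸n+n≡m X≤x)) x<X+X)
    carry : ∀ c → c * X + x ≡ suc c * X + (x ∸ X)
    carry c = begin
      c * X + x               ≡⟨ cong (c * X +_) (m+[n∸m]≡n X≤x) ⟨
      c * X + (X + (x ∸ X))   ≡⟨ +-assoc (c * X) X (x ∸ X) ⟨
      c * X + X + (x ∸ X)     ≡⟨ cong (_+ (x ∸ X)) (+-comm (c * X) X) ⟩
      suc c * X + (x ∸ X)     ∎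

  statePair-replacePrefix : ∀ L {a a′ y} → 1 ≤ a → 1 ≤ a′ → statePair a ≡ statePair a′ →
                            y < b ^ L → statePair (a * b ^ L + y) ≡ statePair (a′ * b ^ L + y)
  statePair-replacePrefix L {a} {a′} {y} 1≤a 1≤a′ eq y<X = cong₂ combine
    (state-replacePrefix₂ L 1≤a 1≤a′ eq (<-≤-trans y<X (m≤m+n X X)))
    (begin
      state (suc (a * X + y))    ≡⟨ cong state (+-suc (a * X) y) ⟨
      state (a * X + suc y)      ≡⟨ state-replacePrefix₂ L 1≤a 1≤a′ eq
                                      (≤-<-trans y<X (m<m+n X (m^n>0 b L))) ⟩
      state (a′ * X + suc y)     ≡⟨ cong state (+-suc (a′ * X) y) ⟩
      state (suc (a′ * X + y))   ∎)
    where
    open ≡-Reasoning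
    X : ℕ
    X = b ^ L

  prefixBound : ℕ
  prefixBound = b ^ (q * q)

  statePair-shorten : ∀ {a} → prefixBound ≤ a →
                      ∃ λ a′ → 1 ≤ a′ × a′ < a × statePair a′ ≡ statePair a
  statePair-shorten {a} B≤a = cut (Fin.pigeonhole (n<1+n (q * q)) (statePair ∘ prefix))
    where
    prefix : Fin (suc (q * q)) → ℕ
    prefix k = dropDigits (toℕ k) a
    prefix>0 : ∀ k → 1 ≤ prefix k
    prefix>0 k = dropDigits>0 {toℕ k} (≤-trans (^-monoʳ-≤ b (≤-pred (Fin.toℕ<n k))) B≤a)
    cut : (∃ λ i → ∃ λ j → toℕ i < toℕ j × statePair (prefix i) ≡ statePair (prefix j)) →
          ∃ λ a′ → 1 ≤ a′ × a′ < a × statePair a′ ≡ statePair a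
    cut (i , j , i<j , eq) = a′ , a′>0 , a′<a , a′∼a
      where
      I : ℕ
      I = toℕ i
      a′ : ℕ
      a′ = prefix j * b ^ I + takeDigits I a
      instance
        b^I≢0 : NonZero (b ^ I)
        b^I≢0 = m^n≢0 b I
      a′>0 : 1 ≤ a′
      a′>0 = ≤-trans (prefix>0 j) (≤-trans (m≤m*n (prefix j) (b ^ I)) (m≤m+n _ _))
      a′<a : a′ < a
      a′<a = subst (a′ <_) (dropDigits*b^+takeDigits I a)
        (+-monoˡ-< (takeDigits I a) (*-monoˡ-< (b ^ I) (dropDigits-decreasing a i<j (prefix>0 j))))
      a′∼a : statePair a′ ≡ statePair a
      a′∼a = trans (statePair-replacePrefix I (prefix>0 j) (prefix>0 i) (sym eq) (takeDigits< I a))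
                   (cong statePair (dropDigits*b^+takeDigits I a))

  SmallRepresentative : ℕ → Set
  SmallRepresentative a = ∃ λ a′ → 1 ≤ a′ × a′ < prefixBound × statePair a′ ≡ statePair a

  statePair-smallRepresentative : ∀ {a} → 1 ≤ a → SmallRepresentative a
  statePair-smallRepresentative {a} = go a (<-wellFounded a)
    where
    go : ∀ a → Acc _<_ a → 1 ≤ a → SmallRepresentative a
    go a (acc rec) 1≤a with a <? prefixBound
    ... | yes a<B = a , 1≤a , a<B , refl
    ... | no  a≮B with statePair-shorten (≮⇒≥ a≮B)
    ...   | a″ , 1≤a″ , a″<a , a″∼a with go a″ (rec a″<a) 1≤a″
    ...     | a′ , 1≤a′ , a′<B , a′∼a″ = a′ , 1≤a′ , a′<B , trans a′∼a″ a″∼a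

  module _ (s : ℕ → Fin m) (s≡ : ∀ n → s n ≡ runDFAO M n) where

    covered-replacePrefix : ∀ {k} {p : Fin k → ℕ} L {a a′ r} → (∀ j → p j ≤ b ^ L) →
                            1 ≤ a → 1 ≤ a′ → statePair a ≡ statePair a′ → r < b ^ L →
                            Covered s p (a′ * b ^ L + r) → Covered s p (a * b ^ L + r)
    covered-replacePrefix {p = p} L {a} {a′} {r} p≤X 1≤a 1≤a′ eq r<X (j , covered) = j , (begin
      s (a * X + r)            ≡⟨ transfer (<-≤-trans r<X (m≤m+n X X)) ⟩
      s (a′ * X + r)           ≡⟨ covered ⟩
      s (a′ * X + r + p j)     ≡⟨ cong s (+-assoc (a′ * X) r (p j)) ⟩
      s (a′ * X + (r + p j))   ≡⟨ transfer (+-mono-<-≤ r<X (p≤X j)) ⟨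
      s (a * X + (r + p j))    ≡⟨ cong s (+-assoc (a * X) r (p j)) ⟨
      s (a * X + r + p j)      ∎)
      where
      open ≡-Reasoning
      X : ℕ
      X = b ^ L
      transfer : ∀ {x} → x < X + X → s (a * X + x) ≡ s (a′ * X + x)
      transfer x<X+X =
        trans (s≡ _) (trans (cong output (state-replacePrefix₂ L 1≤a 1≤a′ eq x<X+X)) (sym (s≡ _)))

    coveredBelow⇒pseudoperiod : ∀ {k} {p : Fin k → ℕ} L → (∀ j → p j ≤ b ^ L) →
                                (∀ i → i < prefixBound * b ^ L → Covered s p i) → HasPseudoperiod s p
    coveredBelow⇒pseudoperiod {p = p} L p≤X coveredBelow i with i <? prefixBound * b ^ L
    ... | yes i<T = coveredBelow i i<T
    ... | no  i≮T = subst (Covered s p) (dropDigits*b^+takeDigits L i)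
                     (fromRepresentative (statePair-smallRepresentative 1≤a))
      where
      1≤a : 1 ≤ dropDigits L i
      1≤a = dropDigits>0 {L} (≤-trans (m≤n*m (b ^ L) prefixBound {{m^n≢0 b (q * q)}}) (≮⇒≥ i≮T))
      fromRepresentative : SmallRepresentative (dropDigits L i) →
                           Covered s p (dropDigits L i * b ^ L + takeDigits L i)
      fromRepresentative (a′ , 1≤a′ , a′<B , a′∼a) =
        covered-replacePrefix L p≤X 1≤a 1≤a′ (sym a′∼a) (takeDigits< L i)
          (coveredBelow _ (m<n∧o<p⇒m*p+o<n*p a′<B (takeDigits< L i)))

corollary6 : (m : ℕ) (s : ℕ → Fin m) → Automatic s →
    (k : ℕ) → ¬ Pseudoperiodic (suc k) s →
    Σ ℕ λ C → (p : Fin (suc k) → ℕ) → ValidPeriods p →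
      Σ ℕ λ n → IsLeastFailure s p n × n ≤ C * p (fromℕ k)
corollary6 m s (b , 1<b , b≢0 , M , s≡) k notPseudoperiodic = prefixBound * b , leastFailure
  where
  open Digits {{b≢0}} 1<b
  open Automaton {{b≢0}} 1<b M

  leastFailure : (p : Fin (suc k) → ℕ) → ValidPeriods p →
                 Σ ℕ λ n → IsLeastFailure s p n × n ≤ prefixBound * b * p (fromℕ k)
  leastFailure p valid with ∃P<b^L≤b*P (proj₁ valid (fromℕ k))
  ... | L , P<b^L , b^L≤bP with allBelow⊎leastCounterexample (covered? s p) (prefixBound * b ^ L)
  ...   | inj₁ coveredBelow = ⊥-elim (notPseudoperiodic (p , valid ,
            coveredBelow⇒pseudoperiod s s≡ L
              (λ j → <⇒≤ (≤-<-trans (ValidPeriods⇒≤last valid j) P<b^L)) coveredBelow))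
  ...   | inj₂ (n , n<T , least) = n , least , (begin
            n                          ≤⟨ <⇒≤ n<T ⟩
            prefixBound * b ^ L        ≤⟨ *-monoʳ-≤ prefixBound b^L≤bP ⟩
            prefixBound * (b * P)      ≡⟨ *-assoc prefixBound b P ⟨
            prefixBound * b * P        ∎)
    where
    open ≤-Reasoning
    P : ℕ
    P = p (fromℕ k)
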